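{- Let $G$ be a finite simple oriented graph that contains a downward 4-cycle, and let $(S_G)$ be a fully traversable pebbling assignment on $G$. Then $G$ is not isomorphic (as a directed graph) to $[S_G]$.
   Context: An oriented graph is a directed graph with no loops, no multiple edges and no pair of opposite edges. A pebbling assignment $(S_G)$ on $G$ assigns a nonnegative integer number of pebbles to each vertex. A pebbling move along an edge $(v,w)$ (allowed when $v$ has at least two pebbles) removes two pebbles from $v$ and adds one pebble to $w$. The assignment graph $[S_G]$ is the directed graph whose vertices are all assignments obtainable from $(S_G)$ by finite sequences of pebbling moves (including $(S_G)$ itself), with a directed edge from $A$ to $B$ whenever $B$ is obtained from $A$ by a single pebbling move. $(S_G)$ is fully traversable if $G$ has at least one edge and for every edge $(v,w)$ of $G$ some assignment reachable from $(S_G)$ admits a pebbling move along $(v,w)$. A downward 4-cycle is a directed graph on four distinct vertices $A,B,C,D$ with edges $A\to B$, $A\to C$, $B\to D$, $C\to D$; $G$ contains one if it has such a subgraph. -}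

module Defs where

open import Data.Nat using (ℕ; _≤_; _∸_; suc)
open import Data.Fin using (Fin)
open import Data.Bool using (Bool; true; false)
open import Data.Vec using (Vec; lookup; updateAt)
open import Data.Product using (Σ; ∃; ∃-syntax; _×_; _,_)
open import Relation.Nullary using (¬_)
open import Relation.Binary.PropositionalEquality using (_≡_; _≢_)
open import Relation.Binary.Construct.Closure.ReflexiveTransitive using (Star)

-- A finite directed graph on vertex set Fin n with a Boolean adjacency
-- relation: adj v w ≡ true means there is an edge v → w.  Being a relation,
-- it has no multiple edges.
record Digraph : Set where
  field
    n   : ℕ
    adj : Fin n → Fin n → Bool

open Digraph public

Edge : (G : Digraph) → Fin (n G) → Fin (n G) → Set
Edge G v w = adj G v w ≡ true

Oriented : Digraph → Set
Oriented G = (∀ v → ¬ Edge G v v) × (∀ v w → Edge G v w → ¬ Edge G w v)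

Assignment : Digraph → Set
Assignment G = Vec ℕ (n G)

applyMove : ∀ {G} → Assignment G → Fin (n G) → Fin (n G) → Assignment G
applyMove A v w = updateAt (updateAt A v (λ x → x ∸ 2)) w suc

Move : (G : Digraph) → Assignment G → Assignment G → Set
Move G A B = ∃[ v ] ∃[ w ] (Edge G v w × 2 ≤ lookup A v × B ≡ applyMove {G} A v w)

Reachable : (G : Digraph) → Assignment G → Assignment G → Set
Reachable G = Star (Move G)

FullyTraversable : (G : Digraph) → Assignment G → Set
FullyTraversable G S =
  (∃[ v ] ∃[ w ] Edge G v w) ×
  (∀ v w → Edge G v w → ∃[ A ] (Reachable G S A × 2 ≤ lookup A v))

HasDownward4Cycle : Digraph → Set
HasDownward4Cycle G = ∃[ a ] ∃[ b ] ∃[ c ] ∃[ d ]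
  ((a ≢ b × a ≢ c × a ≢ d × b ≢ c × b ≢ d × c ≢ d) ×
   (Edge G a b × Edge G a c × Edge G b d × Edge G c d))

-- G is isomorphic, as a directed graph, to the assignment graph [S]:
-- a map f from vertices of G to assignments which is a bijection onto the
-- set of assignments reachable from S, and v → w in G iff f v → f w in [S].
IsoToAssignmentGraph : (G : Digraph) → Assignment G → Set
IsoToAssignmentGraph G S =
  Σ (Fin (n G) → Assignment G) λ f →
    (∀ v → Reachable G S (f v)) ×
    (∀ v w → f v ≡ f w → v ≡ w) ×
    (∀ A → Reachable G S A → ∃[ v ] f v ≡ A) ×
    (∀ v w → (Edge G v w → Move G (f v) (f w)) × (Move G (f v) (f w) → Edge G v w))

{-# OPTIONS --safe #-}
module Submission where

open import Defs
open import Data.Nat using (suc; _≤_; _<_; _∸_; z<s; s≤s⁻¹)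
open import Data.Nat.Properties
  using (≤-refl; ≤-trans; n≤1+n; m∸n≤m; <⇒≱; <-irrefl; ∸-monoʳ-<; module ≤-Reasoning)
open import Data.Fin using (Fin; zero; suc; _≟_)
open import Data.Fin.Properties using (<⇒notInjective; *↔×)
open import Data.Bool as Bool using (true)
open import Data.Vec using (lookup; updateAt)
open import Data.Vec.Properties using (lookup∘updateAt; lookup∘updateAt′)
open import Data.Product using (∃-syntax; _×_; _,_; proj₁; proj₂)
open import Data.Empty using (⊥; ⊥-elim)
open import Function using (_∘_)
open import Function.Bundles using (_↔_; Inverse)
open import Function.Definitions using (Injective; StrictlyInverseˡ; StrictlyInverseʳ)
open import Relation.Nullary using (¬_; yes; no; contradiction)
open import Relation.Binary.PropositionalEquality
  using (_≡_; _≢_; refl; sym; trans; cong; subst; module ≡-Reasoning)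
open import Relation.Binary.Construct.Closure.ReflexiveTransitive using (_◅◅_; return)

-- Under an isomorphism f from G to [S], every move of [S] is made along an edge of G.  Full
-- traversability makes this labelling of the edges of [S] by those of G onto, and the two edge
-- sets have the same size, so it is a bijection: for each edge (p , q) of G at most one reachable
-- assignment has two pebbles on p.  In a downward 4-cycle a → b, a → c, b → d, c → d this forces
-- f b → f d to fire the vertex p that gained a pebble in f a → f b, and forbids f a → f c and
-- f c → f d to fire p; counting the x pebbles of f a on p along a → c → d gives x ≤ (x + 1) ∸ 2
-- with x ≥ 1.

strictlyInverseˡ⇒injective : ∀ {k} {φ ψ : Fin k → Fin k} →
                             StrictlyInverseˡ _≡_ φ ψ → Injective _≡_ _≡_ φ
strictlyInverseˡ⇒injective {k} {φ} {ψ} φψ {x} {y} φx≡φy = begin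
  x        ≡⟨ sym (ψφ x) ⟩
  ψ (φ x)  ≡⟨ cong ψ φx≡φy ⟩
  ψ (φ y)  ≡⟨ ψφ y ⟩
  y        ∎
  where
  open ≡-Reasoning

  ψ-injective : Injective _≡_ _≡_ ψ
  ψ-injective {i} {j} ψi≡ψj = trans (sym (φψ i)) (trans (cong φ ψi≡ψj) (φψ j))

  -- Otherwise z, ψ 0, …, ψ (k - 1) would be k + 1 distinct elements of Fin k.
  ψφ : StrictlyInverseʳ _≡_ φ ψ
  ψφ z with z ≟ ψ (φ z)
  ... | yes z≡ψφz = sym z≡ψφz
  ... | no z≢ψφz = ⊥-elim (<⇒notInjective ≤-refl ext-injective)
    where
    ext : Fin (suc k) → Fin k
    ext zero    = z
    ext (suc i) = ψ i

    z≢ψ : ∀ i → z ≢ ψ i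
    z≢ψ i z≡ψi = z≢ψφz (trans z≡ψi (cong ψ (trans (sym (φψ i)) (cong φ (sym z≡ψi)))))

    ext-injective : Injective _≡_ _≡_ ext
    ext-injective {zero}  {zero}  _     = refl
    ext-injective {zero}  {suc j} z≡ψj  = contradiction z≡ψj (z≢ψ j)
    ext-injective {suc i} {zero}  ψi≡z  = contradiction (sym ψi≡z) (z≢ψ i)
    ext-injective {suc i} {suc j} ψi≡ψj = cong suc (ψ-injective ψi≡ψj)

↔Fin-strictlyInverseˡ⇒injective : ∀ {a} {A : Set a} {k} → Fin k ↔ A → {φ ψ : A → A} →
                                  StrictlyInverseˡ _≡_ φ ψ → Injective _≡_ _≡_ φ
↔Fin-strictlyInverseˡ⇒injective {k = k} A↔Fin {φ} {ψ} φψ {x} {y} φx≡φy = begin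
  x              ≡⟨ sym (to∘from x) ⟩
  to (from x)    ≡⟨ cong to (strictlyInverseˡ⇒injective {φ = φ′} {ψ = ψ′} φ′ψ′ (begin
    φ′ (from x)    ≡⟨ φ′∘from x ⟩
    from (φ x)     ≡⟨ cong from φx≡φy ⟩
    from (φ y)     ≡⟨ φ′∘from y ⟨
    φ′ (from y)    ∎)) ⟩
  to (from y)    ≡⟨ to∘from y ⟩
  y              ∎
  where
  open ≡-Reasoning
  open Inverse A↔Fin using (to; from) renaming (strictlyInverseˡ to to∘from; strictlyInverseʳ to from∘to)

  φ′ ψ′ : Fin k → Fin k
  φ′ = from ∘ φ ∘ to
  ψ′ = from ∘ ψ ∘ to

  φ′∘from : ∀ z → φ′ (from z) ≡ from (φ z)
  φ′∘from z = cong (from ∘ φ) (to∘from z)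

  φ′ψ′ : StrictlyInverseˡ _≡_ φ′ ψ′
  φ′ψ′ i = begin
    φ′ (from (ψ (to i)))  ≡⟨ φ′∘from (ψ (to i)) ⟩
    from (φ (ψ (to i)))   ≡⟨ cong from (φψ (to i)) ⟩
    from (to i)           ≡⟨ from∘to i ⟩
    i                     ∎

module _ (G : Digraph) where

  lookup-applyMove-source : ∀ (A : Assignment G) {v w} → v ≢ w →
                            lookup (applyMove {G} A v w) v ≡ lookup A v ∸ 2
  lookup-applyMove-source A {v} {w} v≢w =
    trans (lookup∘updateAt′ v w v≢w (updateAt A v (_∸ 2))) (lookup∘updateAt v A)

  lookup-applyMove-target : ∀ (A : Assignment G) {v w} → v ≢ w →
                            lookup (applyMove {G} A v w) w ≡ suc (lookup A w)
  lookup-applyMove-target A {v} {w} v≢w =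
    trans (lookup∘updateAt w (updateAt A v (_∸ 2))) (cong suc (lookup∘updateAt′ w v (v≢w ∘ sym) A))

  lookup-applyMove-other : ∀ (A : Assignment G) {v w u} → u ≢ v → u ≢ w →
                           lookup (applyMove {G} A v w) u ≡ lookup A u
  lookup-applyMove-other A {v} {w} {u} u≢v u≢w =
    trans (lookup∘updateAt′ u w u≢w (updateAt A v (_∸ 2))) (lookup∘updateAt′ u v u≢v A)

  lookup-applyMove-≢source : ∀ (A : Assignment G) {v w u} → u ≢ v →
                             lookup A u ≤ lookup (applyMove {G} A v w) u
  lookup-applyMove-≢source A {v} {w} {u} u≢v with u ≟ w
  ... | yes refl = subst (lookup A u ≤_) (sym (lookup-applyMove-target A (u≢v ∘ sym))) (n≤1+n _)
  ... | no u≢w   = subst (lookup A u ≤_) (sym (lookup-applyMove-other A u≢v u≢w)) ≤-refl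

  lookup-applyMove-≢target : ∀ (A : Assignment G) {v w u} → u ≢ w →
                             lookup (applyMove {G} A v w) u ≤ lookup A u
  lookup-applyMove-≢target A {v} {w} {u} u≢w with u ≟ v
  ... | yes refl = subst (_≤ lookup A u) (sym (lookup-applyMove-source A u≢w)) (m∸n≤m _ 2)
  ... | no u≢v   = subst (_≤ lookup A u) (sym (lookup-applyMove-other A u≢v u≢w)) ≤-refl

  applyMove-injective : ∀ (A : Assignment G) {v w v′ w′} → v ≢ w → 2 ≤ lookup A v →
                        applyMove {G} A v w ≡ applyMove {G} A v′ w′ → v ≡ v′ × w ≡ w′
  applyMove-injective A {v} {w} {v′} {w′} v≢w 2≤Av eq with v ≟ v′
  ... | no v≢v′ = contradiction (begin
          lookup A v                          ≤⟨ lookup-applyMove-≢source A v≢v′ ⟩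
          lookup (applyMove {G} A v′ w′) v    ≡⟨ cong (λ B → lookup B v) eq ⟨
          lookup (applyMove {G} A v w) v      ≡⟨ lookup-applyMove-source A v≢w ⟩
          lookup A v ∸ 2                      ∎)
        (<⇒≱ (∸-monoʳ-< z<s 2≤Av))
    where open ≤-Reasoning
  ... | yes refl with w ≟ w′
  ...   | yes w≡w′ = refl , w≡w′
  ...   | no w≢w′  = contradiction (begin
            suc (lookup A w)                 ≡⟨ lookup-applyMove-target A v≢w ⟨
            lookup (applyMove {G} A v w) w   ≡⟨ cong (λ B → lookup B w) eq ⟩
            lookup (applyMove {G} A v w′) w  ≤⟨ lookup-applyMove-≢target A w≢w′ ⟩
            lookup A w                       ∎)
          (<-irrefl refl)
    where open ≤-Reasoning

  label : ∀ {A B} → Move G A B → Fin (n G) × Fin (n G)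
  label (v , w , _) = v , w

  module _ (loopless : ∀ v → ¬ Edge G v v) where

    edge⇒≢ : ∀ {v w} → Edge G v w → v ≢ w
    edge⇒≢ {v} e refl = loopless v e

    move⇒≢ : ∀ {A B} → Move G A B → A ≢ B
    move⇒≢ {A} (v , w , e , 2≤Av , refl) A≡B =
      <-irrefl (cong (λ B → lookup B v) (sym A≡B))
        (subst (_< lookup A v) (sym (lookup-applyMove-source A (edge⇒≢ e))) (∸-monoʳ-< z<s 2≤Av))

    label-unique : ∀ {A B} (m m′ : Move G A B) → label m ≡ label m′
    label-unique {A} (v , w , e , 2≤Av , refl) (v′ , w′ , _ , _ , eq)
      with refl , refl ← applyMove-injective A (edge⇒≢ e) 2≤Av eq = refl

    module _ (S : Assignment G) (traversable : FullyTraversable G S)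
             (f : Fin (n G) → Assignment G)
             (f-onto : ∀ A → Reachable G S A → ∃[ v ] f v ≡ A)
             (f-edges : ∀ v w → (Edge G v w → Move G (f v) (f w)) × (Move G (f v) (f w) → Edge G v w))
             where

      -- Fixing non-edges makes the edge labelling an endomap of the finite set of vertex pairs.
      relabel : Fin (n G) × Fin (n G) → Fin (n G) × Fin (n G)
      relabel (v , w) with adj G v w Bool.≟ true
      ... | yes e = label (proj₁ (f-edges v w) e)
      ... | no _  = v , w

      relabel-move : ∀ {v w} (m : Move G (f v) (f w)) → relabel (v , w) ≡ label m
      relabel-move {v} {w} m with adj G v w Bool.≟ true
      ... | yes e  = label-unique (proj₁ (f-edges v w) e) m
      ... | no ¬e  = contradiction (proj₂ (f-edges v w) m) ¬e

      relabel-nonEdge : ∀ {v w} → ¬ Edge G v w → relabel (v , w) ≡ (v , w)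
      relabel-nonEdge {v} {w} ¬e with adj G v w Bool.≟ true
      ... | yes e = contradiction e ¬e
      ... | no _  = refl

      relabel-fired : ∀ {p q A} → Edge G p q → Reachable G S A → 2 ≤ lookup A p →
                      ∃[ vw ] f (proj₁ vw) ≡ A × relabel vw ≡ (p , q)
      relabel-fired {p} {q} e S↝A 2≤Ap
        with v , refl ← f-onto _ S↝A
        with w , fw≡ ← f-onto _ (S↝A ◅◅ return (p , q , e , 2≤Ap , refl))
        = (v , w) , refl , relabel-move (p , q , e , 2≤Ap , fw≡)

      relabel-onto-edge : ∀ {p q} → Edge G p q → ∃[ vw ] relabel vw ≡ (p , q)
      relabel-onto-edge {p} {q} e with A , S↝A , 2≤Ap ← proj₂ traversable p q e
        with vw , _ , relabeled ← relabel-fired e S↝A 2≤Ap = vw , relabeled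

      unlabel : Fin (n G) × Fin (n G) → Fin (n G) × Fin (n G)
      unlabel (p , q) with adj G p q Bool.≟ true
      ... | yes e = proj₁ (relabel-onto-edge e)
      ... | no _  = p , q

      relabel∘unlabel : StrictlyInverseˡ _≡_ relabel unlabel
      relabel∘unlabel (p , q) with adj G p q Bool.≟ true
      ... | yes e  = proj₂ (relabel-onto-edge e)
      ... | no ¬e  = relabel-nonEdge ¬e

      relabel-injective : Injective _≡_ _≡_ relabel
      relabel-injective = ↔Fin-strictlyInverseˡ⇒injective *↔× relabel∘unlabel

      two-pebbles-unique : ∀ {p q A B} → Edge G p q → Reachable G S A → Reachable G S B →
                           2 ≤ lookup A p → 2 ≤ lookup B p → A ≡ B
      two-pebbles-unique e S↝A S↝B 2≤Ap 2≤Bp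
        with _ , refl , relabeled  ← relabel-fired e S↝A 2≤Ap
           | _ , refl , relabeled′ ← relabel-fired e S↝B 2≤Bp
        = cong (f ∘ proj₁) (relabel-injective (trans relabeled (sym relabeled′)))

    module _ (S : Assignment G)
             (unique : ∀ {p q A B} → Edge G p q → Reachable G S A → Reachable G S B →
                       2 ≤ lookup A p → 2 ≤ lookup B p → A ≡ B)
             where

      next-move-fires-target : ∀ {A B C} → Reachable G S A → (m : Move G A B) (m′ : Move G B C) →
                               proj₁ (label m′) ≡ proj₂ (label m)
      next-move-fires-target {A} S↝A m@(_ , y , _ , _ , refl) (p , _ , e , 2≤Bp , _) with p ≟ y
      ... | yes p≡y = p≡y
      ... | no p≢y  = ⊥-elim (move⇒≢ m (unique e S↝A (S↝A ◅◅ return m)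
                        (≤-trans 2≤Bp (lookup-applyMove-≢target A p≢y)) 2≤Bp))

      downward-square-impossible : ∀ {A B C D} → Reachable G S A → B ≢ C →
                                   Move G A B → Move G A C → Move G B D → Move G C D → ⊥
      downward-square-impossible {A} S↝A B≢C
        mAB@(t , p , tp , _ , refl) mAC@(t′ , z , _ , 2≤At′ , refl) mBD@(p′ , q , pq , 2≤Bp , refl)
        (r , s , _ , 2≤Cr , D≡)
        with refl ← next-move-fires-target S↝A mAB mBD
        = <-irrefl refl (begin-strict
            lookup A p                              ≤⟨ lookup-applyMove-≢source A p≢t′ ⟩
            lookup C p                              ≤⟨ lookup-applyMove-≢source C p≢r ⟩
            lookup (applyMove {G} C r s) p          ≡⟨ cong (λ D → lookup D p) D≡ ⟨
            lookup (applyMove {G} B p q) p          ≡⟨ lookup-applyMove-source B (edge⇒≢ pq) ⟩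
            lookup B p ∸ 2                          ≡⟨ cong (_∸ 2) Bp≡ ⟩
            lookup A p ∸ 1                          <⟨ ∸-monoʳ-< z<s 1≤Ap ⟩
            lookup A p                              ∎)
        where
        open ≤-Reasoning
        B C : Assignment G
        B = applyMove {G} A t p
        C = applyMove {G} A t′ z

        S↝B : Reachable G S B
        S↝B = S↝A ◅◅ return mAB

        Bp≡ : lookup B p ≡ suc (lookup A p)
        Bp≡ = lookup-applyMove-target A (edge⇒≢ tp)

        1≤Ap : 1 ≤ lookup A p
        1≤Ap = s≤s⁻¹ (subst (2 ≤_) Bp≡ 2≤Bp)

        p≢t′ : p ≢ t′
        p≢t′ refl = move⇒≢ mAB (unique pq S↝A S↝B 2≤At′ 2≤Bp)

        p≢r : p ≢ r
        p≢r refl = B≢C (unique pq S↝B (S↝A ◅◅ return mAC) 2≤Bp 2≤Cr)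

theorem2p2 : (G : Digraph) → Oriented G → HasDownward4Cycle G →
    (S : Assignment G) → FullyTraversable G S → ¬ IsoToAssignmentGraph G S
theorem2p2 G (loopless , _) (a , b , c , d , (_ , _ , _ , b≢c , _ , _) , (ab , ac , bd , cd))
           S traversable (f , f-reachable , f-injective , f-onto , f-edges) =
  downward-square-impossible G loopless S (two-pebbles-unique G loopless S traversable f f-onto f-edges)
    (f-reachable a) (b≢c ∘ f-injective b c) (move ab) (move ac) (move bd) (move cd)
  where
  move : ∀ {v w} → Edge G v w → Move G (f v) (f w)
  move {v} {w} = proj₁ (f-edges v w)
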